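{- Let $z^*$ be the item requested in some step and fix an item $y\neq z^*$. If FPM performs a full move in this step, then after the step the flavor of the pair $\{z^*,y\}$ is $d$.
   Context: List Update with a list of items; $a\prec b$ means $a$ is before $b$ in FPM's current list, $a\preceq b$ means $a\prec b$ or $a=b$. Algorithm FPM maintains for each item $x$ a target $\theta_x$ (initially $\theta_x=x$, always $\theta_x\preceq x$). On a request to $z^*$: (1) target cleanup: every $y\ne z^*$ with $\theta_y=z^*$ gets $\theta_y:=$ the successor of $z^*$; (2) movement: a partial move (insert $z^*$ immediately before $\theta_{z^*}$) or a full move (move $z^*$ to the front); (3) target reset: $\theta_{z^*}:=$ the front item. Flavor of a pair $\{x,y\}$ with $y\prec x$: $d$ if $\theta_y\preceq y\prec\theta_x\preceq x$; $o$ if $\theta_y\prec\theta_x\preceq y\prec x$; $e$ if $\theta_y=\theta_x\preceq y\prec x$; $n$ if $\theta_x\prec\theta_y\preceq y\prec x$. -}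

module Defs where

open import Data.Nat using (ℕ)
open import Data.List using (List; []; _∷_; _++_)
open import Data.Product using (Σ; ∃; _×_; _,_)
open import Data.Sum using (_⊎_)
open import Relation.Binary.PropositionalEquality using (_≡_; _≢_)
open import Data.List.Membership.Propositional using (_∈_)

-- Items are labelled by natural numbers; the list is a List ℕ
-- (without duplicates, imposed as a hypothesis where needed).
-- Targets are a function θ : ℕ → ℕ (only its values on list items matter).

Item : Set
Item = ℕ

Targets : Set
Targets = Item → Item

_≺[_]_ : Item → List Item → Item → Set
a ≺[ L ] b = Σ (List Item) λ as → Σ (List Item) λ bs → Σ (List Item) λ cs →
  L ≡ as ++ a ∷ bs ++ b ∷ cs

_⪯[_]_ : Item → List Item → Item → Set
a ⪯[ L ] b = (a ≺[ L ] b) ⊎ ((a ≡ b) × (a ∈ L))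

IsSucc : List Item → Item → Item → Set
IsSucc L a b = Σ (List Item) λ as → Σ (List Item) λ cs → L ≡ as ++ a ∷ b ∷ cs

record FullMoveStep (L : List Item) (θ : Targets) (z : Item)
                    (L' : List Item) (θ' : Targets) : Set where
  field
    move : Σ (List Item) λ as → Σ (List Item) λ bs →
             (L ≡ as ++ z ∷ bs) × (L' ≡ z ∷ as ++ bs)
    cleanup-hit  : ∀ y → y ≢ z → θ y ≡ z → IsSucc L z (θ' y)
    cleanup-miss : ∀ y → y ≢ z → θ y ≢ z → θ' y ≡ θ y
    reset : Σ (List Item) λ rest → L' ≡ θ' z ∷ rest

data Flavor : Set where
  d o e n : Flavor

-- Flavor condition for the ordered pair (x , y) with y ≺ x
FlavorCond : Flavor → List Item → Targets → Item → Item → Set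
FlavorCond d L θ x y = (θ y ⪯[ L ] y) × (y ≺[ L ] θ x) × (θ x ⪯[ L ] x)
FlavorCond o L θ x y = (θ y ≺[ L ] θ x) × (θ x ⪯[ L ] y) × (y ≺[ L ] x)
FlavorCond e L θ x y = (θ y ≡ θ x) × (θ x ⪯[ L ] y) × (y ≺[ L ] x)
FlavorCond n L θ x y = (θ x ≺[ L ] θ y) × (θ y ⪯[ L ] y) × (y ≺[ L ] x)

PairHasFlavor : Flavor → List Item → Targets → Item → Item → Set
PairHasFlavor f L θ a b =
  ((b ≺[ L ] a) × FlavorCond f L θ a b) ⊎ ((a ≺[ L ] b) × FlavorCond f L θ b a)

{-# OPTIONS --safe #-}
-- After a full move z* is at the front and is its own target, so the pair
-- {z*, y} is of flavor d as soon as z* ≺ θ' y ⪯ y.  Moving z* to the front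
-- preserves the order of all other items, so it suffices that θ' y ≠ z* and
-- θ' y ⪯ y already held before the move.  If the cleanup left θ y alone this
-- is the invariant θ y ⪯ y; otherwise θ y = z* ≺ y, and the new target, the
-- successor of z*, is still ⪯ y because z* occurs only once in the list.
module Submission where

open import Defs
open import Data.List using (List; []; _∷_; _++_; [_])
open import Data.List.Relation.Unary.Unique.Propositional using (Unique)
open import Data.List.Relation.Unary.Unique.Propositional.Properties
  using (Unique[x∷xs]⇒x∉xs)
open import Data.List.Relation.Unary.AllPairs using (_∷_)
open import Data.List.Relation.Unary.Any using (here; there)
open import Data.List.Membership.Propositional using (_∈_; _∉_)
open import Data.List.Membership.Propositional.Properties using (∈-∃++; ∈-++⁺ʳ)
open import Data.List.Relation.Binary.Sublist.Propositional
  using (_⊆_; _∷_; _∷ʳ_; from∈; to∈)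
open import Data.List.Relation.Binary.Sublist.Propositional.Properties using (++⁺ˡ)
open import Data.List.Relation.Binary.Permutation.Propositional.Properties
  using (∈-resp-↭; shift)
open import Data.List.Properties using (∷-injectiveˡ)
open import Data.Product using (_×_; _,_)
open import Data.Sum using (inj₁; inj₂)
open import Data.Empty using (⊥-elim)
open import Data.Nat using (_≟_)
open import Function using (_∘_)
open import Relation.Nullary using (yes; no)
open import Relation.Binary.PropositionalEquality
  using (_≡_; _≢_; refl; sym; cong; subst)

private
  variable
    a b s z : Item
    L : List Item

≺⇒⊆ : a ≺[ L ] b → a ∷ [ b ] ⊆ L
≺⇒⊆ (as , bs , cs , refl) = ++⁺ˡ as (refl ∷ ++⁺ˡ bs (from∈ (here refl)))

⊆⇒≺ : a ∷ [ b ] ⊆ L → a ≺[ L ] b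
⊆⇒≺ (x ∷ʳ p) with as , bs , cs , eq ← ⊆⇒≺ p = x ∷ as , bs , cs , cong (x ∷_) eq
⊆⇒≺ (refl ∷ p) with bs , cs , eq ← ∈-∃++ (to∈ p) = [] , bs , cs , cong (_ ∷_) eq

⪯⇒∈ : a ⪯[ L ] b → a ∈ L
⪯⇒∈ (inj₁ a≺b)     = to∈ (≺⇒⊆ a≺b)
⪯⇒∈ (inj₂ (_ , m)) = m

≺-head : ∀ {xs} → a ≢ z → a ∈ z ∷ xs → z ≺[ z ∷ xs ] a
≺-head a≢z (here a≡z) = ⊥-elim (a≢z a≡z)
≺-head a≢z (there m)  = ⊆⇒≺ (refl ∷ from∈ m)

Unique-++⁻ʳ : ∀ ps {xs : List Item} → Unique (ps ++ xs) → Unique xs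
Unique-++⁻ʳ []       u       = u
Unique-++⁻ʳ (_ ∷ ps) (_ ∷ u) = Unique-++⁻ʳ ps u

⊆-remove : ∀ as {bs xs} → z ∉ xs → xs ⊆ as ++ z ∷ bs → xs ⊆ as ++ bs
⊆-remove []       z∉xs (_ ∷ʳ p)   = p
⊆-remove []       z∉xs (refl ∷ p) = ⊥-elim (z∉xs (here refl))
⊆-remove (x ∷ as) z∉xs (_ ∷ʳ p)   = x ∷ʳ ⊆-remove as z∉xs p
⊆-remove (x ∷ as) z∉xs (refl ∷ p) = refl ∷ ⊆-remove as (z∉xs ∘ there) p

≺-moveToFront : ∀ as {bs} → a ≢ z → b ≢ z →
                a ≺[ as ++ z ∷ bs ] b → a ≺[ z ∷ as ++ bs ] b
≺-moveToFront {z = z} as a≢z b≢z a≺b = ⊆⇒≺ (z ∷ʳ ⊆-remove as z∉ab (≺⇒⊆ a≺b))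
  where
  z∉ab : z ∉ _ ∷ [ _ ]
  z∉ab (here z≡a)         = a≢z (sym z≡a)
  z∉ab (there (here z≡b)) = b≢z (sym z≡b)

∈-moveToFront : ∀ as {bs} → a ∈ as ++ z ∷ bs → a ∈ z ∷ as ++ bs
∈-moveToFront {z = z} as {bs} = ∈-resp-↭ (shift z as bs)

⪯-moveToFront : ∀ as {bs} → a ≢ z → b ≢ z →
                a ⪯[ as ++ z ∷ bs ] b → a ⪯[ z ∷ as ++ bs ] b
⪯-moveToFront as a≢z b≢z (inj₁ a≺b)       = inj₁ (≺-moveToFront as a≢z b≢z a≺b)
⪯-moveToFront as a≢z b≢z (inj₂ (a≡b , m)) = inj₂ (a≡b , ∈-moveToFront as m)

unique-⊆⇒∈-suffix : ∀ ps {rest} → Unique (ps ++ a ∷ rest) →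
                   a ∷ [ b ] ⊆ ps ++ a ∷ rest → b ∈ rest
unique-⊆⇒∈-suffix []       u        (_ ∷ʳ p)   = ⊥-elim (Unique[x∷xs]⇒x∉xs u (to∈ p))
unique-⊆⇒∈-suffix []       u        (refl ∷ p) = to∈ p
unique-⊆⇒∈-suffix (_ ∷ ps) (_ ∷ u)  (_ ∷ʳ p)   = unique-⊆⇒∈-suffix ps u p
unique-⊆⇒∈-suffix (_ ∷ ps) u        (refl ∷ p) =
  ⊥-elim (Unique[x∷xs]⇒x∉xs u (∈-++⁺ʳ ps (here refl)))

IsSucc-unique⇒≢ : Unique L → IsSucc L a s → s ≢ a
IsSucc-unique⇒≢ u (ps , qs , refl) s≡a =
  Unique[x∷xs]⇒x∉xs (Unique-++⁻ʳ ps u) (here (sym s≡a))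

IsSucc-unique⇒⪯ : Unique L → IsSucc L a s → a ≺[ L ] b → s ⪯[ L ] b
IsSucc-unique⇒⪯ u (ps , qs , refl) a≺b with unique-⊆⇒∈-suffix ps u (≺⇒⊆ a≺b)
... | here refl  = inj₂ (refl , ∈-++⁺ʳ ps (there (here refl)))
... | there b∈qs = inj₁ (⊆⇒≺ (++⁺ˡ ps (_ ∷ʳ (refl ∷ from∈ b∈qs))))

cleanup-target : ∀ {L θ z L′ θ′ y} → Unique L → FullMoveStep L θ z L′ θ′ →
                 y ≢ z → θ y ⪯[ L ] y → θ′ y ≢ z × θ′ y ⪯[ L ] y
cleanup-target {L} {θ} {z} {θ′ = θ′} {y} u step y≢z θy⪯y with θ y ≟ z
... | no θy≢z rewrite FullMoveStep.cleanup-miss step y y≢z θy≢z = θy≢z , θy⪯y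
... | yes θy≡z = IsSucc-unique⇒≢ u succ , IsSucc-unique⇒⪯ u succ z≺y
  where
  succ : IsSucc L z (θ′ y)
  succ = FullMoveStep.cleanup-hit step y y≢z θy≡z
  z≺y : z ≺[ L ] y
  z≺y with subst (_⪯[ L ] y) θy≡z θy⪯y
  ... | inj₁ z≺y       = z≺y
  ... | inj₂ (z≡y , _) = ⊥-elim (y≢z (sym z≡y))

reset-front : ∀ {L θ z L′ θ′ rest} → FullMoveStep L θ z L′ θ′ → L′ ≡ z ∷ rest → θ′ z ≡ z
reset-front step refl with _ , eq ← FullMoveStep.reset step = sym (∷-injectiveˡ eq)

-- The hypothesis z ∈ L is unused: FullMoveStep.move already locates z in L.
lemma4p3 : (L : List Item) (θ : Targets) (z y : Item)
    → Unique L
    → z ∈ L → y ∈ L → y ≢ z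
    → (∀ x → x ∈ L → θ x ⪯[ L ] x)
    → (L' : List Item) (θ' : Targets)
    → FullMoveStep L θ z L' θ'
    → PairHasFlavor d L' θ' z y
lemma4p3 L θ z y u _ y∈L y≢z θ⪯ L' θ' step
  with as , bs , refl , refl ← FullMoveStep.move step
     | θ'y≢z , θ'y⪯y ← cleanup-target u step y≢z (θ⪯ y y∈L)
  = inj₂ (≺-head y≢z (∈-moveToFront as y∈L) , θ'z⪯z , ≺-head θ'y≢z (⪯⇒∈ θ'y⪯'y) , θ'y⪯'y)
  where
  θ'z≡z : θ' z ≡ z
  θ'z≡z = reset-front step refl
  θ'z⪯z : θ' z ⪯[ L' ] z
  θ'z⪯z = inj₂ (θ'z≡z , here θ'z≡z)
  θ'y⪯'y : θ' y ⪯[ L' ] y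
  θ'y⪯'y = ⪯-moveToFront as θ'y≢z y≢z θ'y⪯y
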